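{- For every integer $k \geq 1$ and every vertex $v$ of the twincut graph $G_k$, there exists a proper coloring of $G_k$ with colors $\{1,\dots,k\}$ in which $v$ is the only vertex with color $k$. Furthermore, if $v$ is a branch vertex of $G_k$, this coloring can be chosen so that additionally, for every $i$, the neighbor of $v$ lying at level $i$ of $T_k$ has color $i$.
   Context: A structured tree is a pair $(T,g)$ where $T$ is a rooted tree and $g$ is a function defined on the internal (non-leaf) nodes $v$ of $T$ such that $g(v)$ is a graph whose vertex set is the set of children of $v$ in $T$. A branch of $T$ is a path in $T$ from the root to a leaf. The realization $R(T,g)$ is the graph with vertex set $V(T)\cup B$, where $B$ is a set of new vertices in bijection with the branches of $T$ (called branch vertices). Its edges are: all pairs $uv$ where $u,v$ are children of a common internal node $z$ and $uv$ is an edge of $g(z)$; and, for each branch vertex $b$, all pairs $bw$ with $w$ a node of $T$ lying on the branch $b$. The edges of $T$ itself are not edges of $R(T,g)$. (If $T$ is a single root vertex, $R(T,g)=K_2$.) The twincut graphs $G_1,G_2,\dots$ are defined inductively: $G_1$ is the one-vertex graph; for $k\ge 2$, $G_k=R(T_k,g_k)$ where $T_k$ is the rooted tree with $k-1$ levels (the root is at level $1$) in which every node $v$ at level $i<k-1$ has exactly $|V(G_{i+1})|$ children and $g_k(v)$ is a copy of $G_{i+1}$ on these children (nodes at level $k-1$ are leaves). Thus a branch vertex of $G_k$ is adjacent to exactly one node of $T_k$ at each level $1,\dots,k-1$. -}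

module Defs where

open import Data.Nat using (ℕ; zero; suc; _≤_)
open import Data.Unit using (⊤; tt)
open import Data.Empty using (⊥)
open import Data.Sum using (_⊎_; inj₁; inj₂)
open import Data.Product using (_×_; _,_)
open import Relation.Binary.PropositionalEquality using (_≡_; _≢_)

-- W n      = vertex set of the twincut graph G_(n+1).
-- Seq j    = sequences (c_1,...,c_j) with c_m ∈ V(G_(m+1)) = W m;
--            a sequence of length j is the node of the tree reached from the
--            root by choosing child c_1, then c_2, ...; it lies at level j+1.
-- Nodes n  = all nodes of T_(n+2), i.e. sequences of length 0..n
--            (levels 1..n+1); leaves are the sequences of length n.
-- V(G_(n+2)) = Nodes n ⊎ Seq n  (tree nodes ⊎ branch vertices; a branch
--            is identified with its leaf, a sequence of length n).
mutual
  W : ℕ → Set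
  W zero = ⊤
  W (suc n) = Nodes n ⊎ Seq n

  Nodes : ℕ → Set
  Nodes zero = Seq zero
  Nodes (suc n) = Nodes n ⊎ Seq (suc n)

  Seq : ℕ → Set
  Seq zero = ⊤
  Seq (suc j) = Seq j × W (suc j)

-- Pre n x b : tree node x of T_(n+2) lies on the branch b (x is a prefix of b).
Pre : ∀ n → Nodes n → Seq n → Set
Pre zero _ _ = ⊤
Pre (suc n) (inj₁ x) (s , _) = Pre n x s
Pre (suc n) (inj₂ s) t = s ≡ t

-- level (1-based) of a tree node of T_(n+2)
levelN : ∀ n → Nodes n → ℕ
levelN zero _ = 1
levelN (suc n) (inj₁ x) = levelN n x
levelN (suc n) (inj₂ _) = suc (suc n)

mutual
  AdjW : ∀ n → W n → W n → Set
  AdjW zero _ _ = ⊥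
  AdjW (suc n) (inj₁ x) (inj₁ y) = AdjN n x y
  AdjW (suc n) (inj₁ x) (inj₂ b) = Pre n x b
  AdjW (suc n) (inj₂ b) (inj₁ x) = Pre n x b
  AdjW (suc n) (inj₂ _) (inj₂ _) = ⊥

  -- adjacency between tree nodes: siblings adjacent in g(parent)
  AdjN : ∀ n → Nodes n → Nodes n → Set
  AdjN zero _ _ = ⊥
  AdjN (suc n) (inj₁ x) (inj₁ y) = AdjN n x y
  AdjN (suc n) (inj₁ _) (inj₂ _) = ⊥
  AdjN (suc n) (inj₂ _) (inj₁ _) = ⊥
  AdjN (suc n) (inj₂ s) (inj₂ t) = AdjS (suc n) s t

  AdjS : ∀ j → Seq j → Seq j → Set
  AdjS zero _ _ = ⊥
  AdjS (suc j) (s , a) (t , b) = (s ≡ t) × AdjW (suc j) a b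

-- The twincut graph G_k (k ≥ 1); G_0 is not defined and is given no vertices.
V : ℕ → Set
V zero = ⊥
V (suc n) = W n

Adj : ∀ k → V k → V k → Set
Adj zero () _
Adj (suc n) = AdjW n

IsBranch : ∀ k → V k → Set
IsBranch (suc (suc n)) (inj₂ _) = ⊤
IsBranch _ _ = ⊥

AtLevel : ∀ k → V k → ℕ → Set
AtLevel (suc (suc n)) (inj₁ x) i = levelN n x ≡ i
AtLevel _ _ _ = ⊥

ProperColoring : ∀ k → (V k → ℕ) → Set
ProperColoring k c =
  (∀ u → (1 ≤ c u) × (c u ≤ k)) × (∀ u w → Adj k u w → c u ≢ c w)

-- Given a branch t of T_k, colour each tree node on level j + 1 (j ≥ 1) by
-- the colouring of G_(j+1) in which the j-th coordinate of t is the unique vertex of colour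
-- j + 1. Every node then gets a colour at most its level, and exactly the nodes on t get
-- their own level. A branch vertex b gets the deepest level on b whose node is not coloured
-- by its level, and colour k if there is none, i.e. if b = t. This makes t the unique vertex
-- of colour k. For a tree node x, recolour x with k in the colouring of a branch t through x:
-- no branch vertex can then get colour k, since that would force b = t while x lies on t.
module Submission where

open import Defs
open import Data.Nat using (ℕ; zero; suc; _≤_; z≤n; s≤s)
open import Data.Nat.Properties
  using (_≟_; ≤-refl; ≤-trans; m≤n⇒m≤1+n; n≤1+n; 1+n≰n; <⇒≢)
open import Data.Unit using (tt)
import Data.Unit.Properties as Unit
open import Data.Empty using (⊥-elim)
open import Data.Sum using (_⊎_; inj₁; inj₂)
import Data.Sum.Properties as ⊎
open import Data.Product using (Σ; _×_; _,_; proj₁; proj₂)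
import Data.Product.Properties as ×
open import Function using (_∘_)
open import Relation.Binary.Definitions using (DecidableEquality)
open import Relation.Binary.PropositionalEquality
  using (_≡_; _≢_; refl; sym; trans; cong; cong₂; subst)
open import Relation.Nullary using (yes; no)

≤⇒≢suc : ∀ {a b} → a ≤ b → a ≢ suc b
≤⇒≢suc a≤b = <⇒≢ (s≤s a≤b)

mutual
  decEqW : ∀ n → DecidableEquality (W n)
  decEqW zero = Unit._≟_
  decEqW (suc n) = ⊎.≡-dec (decEqNodes n) (decEqSeq n)

  decEqNodes : ∀ n → DecidableEquality (Nodes n)
  decEqNodes zero = Unit._≟_
  decEqNodes (suc n) = ⊎.≡-dec (decEqNodes n) (decEqSeq (suc n))

  decEqSeq : ∀ n → DecidableEquality (Seq n)
  decEqSeq zero = Unit._≟_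
  decEqSeq (suc j) = ×.≡-dec (decEqSeq j) (decEqW (suc j))

mutual
  inhabitantW : ∀ n → W n
  inhabitantW zero = tt
  inhabitantW (suc n) = inj₂ (inhabitantSeq n)

  inhabitantSeq : ∀ n → Seq n
  inhabitantSeq zero = tt
  inhabitantSeq (suc j) = inhabitantSeq j , inhabitantW (suc j)

branchThrough : ∀ n → Nodes n → Seq n
branchThrough zero x = x
branchThrough (suc n) (inj₁ x) = branchThrough n x , inhabitantW (suc n)
branchThrough (suc n) (inj₂ s) = s

onBranchThrough : ∀ n x → Pre n x (branchThrough n x)
onBranchThrough zero x = tt
onBranchThrough (suc n) (inj₁ x) = onBranchThrough n x
onBranchThrough (suc n) (inj₂ s) = refl

levelN≤ : ∀ n x → levelN n x ≤ suc n
levelN≤ zero x = ≤-refl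
levelN≤ (suc n) (inj₁ x) = m≤n⇒m≤1+n (levelN≤ n x)
levelN≤ (suc n) (inj₂ _) = ≤-refl

ColouredByLevelAlong : ∀ n → (Nodes n → ℕ) → Seq n → Set
ColouredByLevelAlong n f b = ∀ x → Pre n x b → f x ≡ levelN n x

-- The deepest level ℓ at which the node of the branch b has f-colour other than ℓ,
-- and 0 if there is no such level.
deepestDefect : ∀ n → (Nodes n → ℕ) → Seq n → ℕ
deepestDefect zero f b with f b ≟ 1
... | yes _ = 0
... | no _ = 1
deepestDefect (suc n) f (s , a) with f (inj₂ (s , a)) ≟ suc (suc n)
... | yes _ = deepestDefect n (f ∘ inj₁) s
... | no _ = suc (suc n)

deepestDefect≤ : ∀ n f b → deepestDefect n f b ≤ suc n
deepestDefect≤ zero f b with f b ≟ 1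
... | yes _ = z≤n
... | no _ = s≤s z≤n
deepestDefect≤ (suc n) f (s , a) with f (inj₂ (s , a)) ≟ suc (suc n)
... | yes _ = m≤n⇒m≤1+n (deepestDefect≤ n (f ∘ inj₁) s)
... | no _ = ≤-refl

byLevel⇒deepestDefect≡0 : ∀ n f b → ColouredByLevelAlong n f b → deepestDefect n f b ≡ 0
byLevel⇒deepestDefect≡0 zero f b byLevel with f b ≟ 1
... | yes _ = refl
... | no f≢1 = ⊥-elim (f≢1 (byLevel b tt))
byLevel⇒deepestDefect≡0 (suc n) f (s , a) byLevel with f (inj₂ (s , a)) ≟ suc (suc n)
... | yes _ = byLevel⇒deepestDefect≡0 n (f ∘ inj₁) s (byLevel ∘ inj₁)
... | no f≢level = ⊥-elim (f≢level (byLevel (inj₂ (s , a)) refl))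

deepestDefect≡0⇒byLevel : ∀ n f b → deepestDefect n f b ≡ 0 → ColouredByLevelAlong n f b
deepestDefect≡0⇒byLevel zero f b d≡0 x p with f b ≟ 1
... | yes f≡1 = f≡1
deepestDefect≡0⇒byLevel zero f b () x p | no _
deepestDefect≡0⇒byLevel (suc n) f (s , a) d≡0 x p with f (inj₂ (s , a)) ≟ suc (suc n)
deepestDefect≡0⇒byLevel (suc n) f (s , a) d≡0 (inj₁ y) p | yes _ =
  deepestDefect≡0⇒byLevel n (f ∘ inj₁) s d≡0 y p
deepestDefect≡0⇒byLevel (suc n) f (s , a) d≡0 (inj₂ _) refl | yes f≡level = f≡level
deepestDefect≡0⇒byLevel (suc n) f (s , a) () x p | no _

TopOrBelowLevelAlong : ∀ n → (Nodes n → ℕ) → Seq n → Set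
TopOrBelowLevelAlong n f b = ∀ x → Pre n x b → f x ≤ levelN n x ⊎ suc (suc n) ≤ f x

TopOrBelowLevelAlong-parent : ∀ n f s a →
  TopOrBelowLevelAlong (suc n) f (s , a) → TopOrBelowLevelAlong n (f ∘ inj₁) s
TopOrBelowLevelAlong-parent n f s a h y p with h (inj₁ y) p
... | inj₁ below = inj₁ below
... | inj₂ above = inj₂ (≤-trans (n≤1+n _) above)

-- At the deepest defect ℓ the node has colour ≢ ℓ, deeper nodes have their own levels,
-- and shallower nodes have colour ≤ their level < ℓ.
deepestDefect-avoided : ∀ n f b → TopOrBelowLevelAlong n f b →
  ∀ m → deepestDefect n f b ≡ suc m → ∀ x → Pre n x b → f x ≢ suc m
deepestDefect-avoided zero f b h m d≡ x p with f b ≟ 1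
deepestDefect-avoided zero f b h m () x p | yes _
deepestDefect-avoided zero f b h .zero refl x p | no f≢1 = f≢1
deepestDefect-avoided (suc n) f (s , a) h m d≡ x p with f (inj₂ (s , a)) ≟ suc (suc n)
deepestDefect-avoided (suc n) f (s , a) h m d≡ (inj₁ y) p | yes _ =
  deepestDefect-avoided n (f ∘ inj₁) s (TopOrBelowLevelAlong-parent n f s a h) m d≡ y p
deepestDefect-avoided (suc n) f (s , a) h m d≡ (inj₂ _) refl | yes f≡level = λ f≡m →
  ≤⇒≢suc (subst (_≤ suc n) d≡ (deepestDefect≤ n (f ∘ inj₁) s)) (trans (sym f≡m) f≡level)
deepestDefect-avoided (suc n) f (s , a) h .(suc n) refl (inj₁ y) p | no _ with h (inj₁ y) p
... | inj₁ below = ≤⇒≢suc (≤-trans below (levelN≤ n y))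
... | inj₂ above = λ f≡ → 1+n≰n (subst (suc (suc (suc n)) ≤_) f≡ above)
deepestDefect-avoided (suc n) f (s , a) h .(suc n) refl (inj₂ _) refl | no f≢level = f≢level

zeroTo : ℕ → ℕ → ℕ
zeroTo k zero = k
zeroTo k (suc m) = suc m

branchColour : ∀ n → (Nodes n → ℕ) → Seq n → ℕ
branchColour n f b = zeroTo (suc (suc n)) (deepestDefect n f b)

branchColour-range : ∀ n f b → 1 ≤ branchColour n f b × branchColour n f b ≤ suc (suc n)
branchColour-range n f b with deepestDefect n f b | deepestDefect≤ n f b
... | zero | _ = s≤s z≤n , ≤-refl
... | suc m | d≤ = s≤s z≤n , m≤n⇒m≤1+n d≤

branchColour-avoids : ∀ n f b → TopOrBelowLevelAlong n f b →
  ∀ x → Pre n x b → f x ≢ branchColour n f b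
branchColour-avoids n f b h x p with deepestDefect n f b in d≡
... | zero =
  ≤⇒≢suc (subst (_≤ suc n) (sym (deepestDefect≡0⇒byLevel n f b d≡ x p)) (levelN≤ n x))
... | suc m = deepestDefect-avoided n f b h m d≡ x p

byLevel⇒branchColour≡top : ∀ n f b →
  ColouredByLevelAlong n f b → branchColour n f b ≡ suc (suc n)
byLevel⇒branchColour≡top n f b byLevel =
  cong (zeroTo (suc (suc n))) (byLevel⇒deepestDefect≡0 n f b byLevel)

branchColour≡top⇒byLevel : ∀ n f b →
  branchColour n f b ≡ suc (suc n) → ColouredByLevelAlong n f b
branchColour≡top⇒byLevel n f b bc≡top with deepestDefect n f b in d≡
... | zero = deepestDefect≡0⇒byLevel n f b d≡
... | suc m = ⊥-elim (≤⇒≢suc (subst (_≤ suc n) d≡ (deepestDefect≤ n f b)) bc≡top)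

extendToBranches : ∀ n → (Nodes n → ℕ) → W (suc n) → ℕ
extendToBranches n f (inj₁ x) = f x
extendToBranches n f (inj₂ b) = branchColour n f b

extendToBranches-proper : ∀ n f →
  (∀ x → 1 ≤ f x × f x ≤ suc (suc n)) →
  (∀ x y → AdjN n x y → f x ≢ f y) →
  (∀ b → TopOrBelowLevelAlong n f b) →
  ProperColoring (suc (suc n)) (extendToBranches n f)
extendToBranches-proper n f range proper h = range′ , proper′
  where
  range′ : ∀ u → 1 ≤ extendToBranches n f u × extendToBranches n f u ≤ suc (suc n)
  range′ (inj₁ x) = range x
  range′ (inj₂ b) = branchColour-range n f b
  proper′ : ∀ u w → AdjW (suc n) u w → extendToBranches n f u ≢ extendToBranches n f w
  proper′ (inj₁ x) (inj₁ y) adj = proper x y adj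
  proper′ (inj₁ x) (inj₂ b) p = branchColour-avoids n f b (h b) x p
  proper′ (inj₂ b) (inj₁ x) p = branchColour-avoids n f b (h b) x p ∘ sym
  proper′ (inj₂ _) (inj₂ _) ()

recolour : ∀ n → Nodes n → ℕ → (Nodes n → ℕ) → Nodes n → ℕ
recolour n x c f y with decEqNodes n y x
... | yes _ = c
... | no _ = f y

recolour-view : ∀ n x c f y →
  (y ≡ x × recolour n x c f y ≡ c) ⊎ (y ≢ x × recolour n x c f y ≡ f y)
recolour-view n x c f y with decEqNodes n y x
... | yes y≡x = inj₁ (y≡x , refl)
... | no y≢x = inj₂ (y≢x , refl)

recolour-self : ∀ n x c f → recolour n x c f x ≡ c
recolour-self n x c f with recolour-view n x c f x
... | inj₁ (_ , r≡c) = r≡c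
... | inj₂ (x≢x , _) = ⊥-elim (x≢x refl)

-- colouring n v is a colouring of G_(n+1) in which v is meant to be the only vertex of
-- colour n + 1; treeColouring n t colours the nodes of T_(n+2) from the branch t.
mutual
  colouring : ∀ n → W n → W n → ℕ
  colouring zero _ _ = 1
  colouring (suc n) (inj₁ x) =
    extendToBranches n (recolour n x (suc (suc n)) (treeColouring n (branchThrough n x)))
  colouring (suc n) (inj₂ t) = extendToBranches n (treeColouring n t)

  treeColouring : ∀ n → Seq n → Nodes n → ℕ
  treeColouring zero _ _ = 1
  treeColouring (suc n) (t , u) (inj₁ x) = treeColouring n t x
  treeColouring (suc n) (t , u) (inj₂ (s , a)) = colouring (suc n) u a

IsTopColouring : ∀ n → W n → (W n → ℕ) → Set
IsTopColouring n v c = ProperColoring (suc n) c × c v ≡ suc n × (∀ u → c u ≡ suc n → u ≡ v)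

mutual
  colouring-isTop : ∀ n v → IsTopColouring n v (colouring n v)
  colouring-isTop zero tt = ((λ _ → s≤s z≤n , s≤s z≤n) , λ _ _ ()) , refl , λ { tt _ → refl }
  colouring-isTop (suc n) (inj₁ x) = treeNode-isTop n x
  colouring-isTop (suc n) (inj₂ t) = branchVertex-isTop n t

  treeColouring-range : ∀ n t x → 1 ≤ treeColouring n t x × treeColouring n t x ≤ levelN n x
  treeColouring-range zero t x = s≤s z≤n , s≤s z≤n
  treeColouring-range (suc n) (t , u) (inj₁ x) = treeColouring-range n t x
  treeColouring-range (suc n) (t , u) (inj₂ (s , a)) =
    proj₁ (proj₁ (colouring-isTop (suc n) u)) a

  treeColouring-proper : ∀ n t x y → AdjN n x y → treeColouring n t x ≢ treeColouring n t y
  treeColouring-proper (suc n) (t , u) (inj₁ x) (inj₁ y) adj = treeColouring-proper n t x y adj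
  treeColouring-proper (suc n) (t , u) (inj₂ (s , a)) (inj₂ (s′ , b)) (_ , adj) =
    proj₂ (proj₁ (colouring-isTop (suc n) u)) a b adj

  treeColouring-byLevel : ∀ n t → ColouredByLevelAlong n (treeColouring n t) t
  treeColouring-byLevel zero t x p = refl
  treeColouring-byLevel (suc n) (t , u) (inj₁ x) p = treeColouring-byLevel n t x p
  treeColouring-byLevel (suc n) (t , u) (inj₂ (s , a)) refl =
    proj₁ (proj₂ (colouring-isTop (suc n) u))

  treeColouring-byLevel-unique : ∀ n t b →
    ColouredByLevelAlong n (treeColouring n t) b → b ≡ t
  treeColouring-byLevel-unique zero tt tt _ = refl
  treeColouring-byLevel-unique (suc n) (t , u) (s , a) byLevel =
    cong₂ _,_ (treeColouring-byLevel-unique n t s (byLevel ∘ inj₁))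
              (proj₂ (proj₂ (colouring-isTop (suc n) u)) a (byLevel (inj₂ (s , a)) refl))

  treeColouring≤ : ∀ n t x → treeColouring n t x ≤ suc n
  treeColouring≤ n t x = ≤-trans (proj₂ (treeColouring-range n t x)) (levelN≤ n x)

  branchVertex-isTop : ∀ n t →
    IsTopColouring (suc n) (inj₂ t) (colouring (suc n) (inj₂ t))
  branchVertex-isTop n t =
    extendToBranches-proper n f range (treeColouring-proper n t) below ,
    byLevel⇒branchColour≡top n f t (treeColouring-byLevel n t) ,
    unique
    where
    f : Nodes n → ℕ
    f = treeColouring n t
    range : ∀ x → 1 ≤ f x × f x ≤ suc (suc n)
    range x = proj₁ (treeColouring-range n t x) , m≤n⇒m≤1+n (treeColouring≤ n t x)
    below : ∀ b → TopOrBelowLevelAlong n f b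
    below b x _ = inj₁ (proj₂ (treeColouring-range n t x))
    unique : ∀ u → extendToBranches n f u ≡ suc (suc n) → u ≡ inj₂ t
    unique (inj₁ x) f≡top = ⊥-elim (≤⇒≢suc (treeColouring≤ n t x) f≡top)
    unique (inj₂ b) bc≡top =
      cong inj₂ (treeColouring-byLevel-unique n t b (branchColour≡top⇒byLevel n f b bc≡top))

  treeNode-isTop : ∀ n x →
    IsTopColouring (suc n) (inj₁ x) (colouring (suc n) (inj₁ x))
  treeNode-isTop n x =
    extendToBranches-proper n f range proper topOrBelow ,
    recolour-self n x top g ,
    unique
    where
    top = suc (suc n)
    t = branchThrough n x
    g = treeColouring n t
    f = recolour n x top g
    range : ∀ y → 1 ≤ f y × f y ≤ top
    range y with recolour-view n x top g y
    ... | inj₁ (_ , f≡top) rewrite f≡top = s≤s z≤n , ≤-refl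
    ... | inj₂ (_ , f≡g) rewrite f≡g =
      proj₁ (treeColouring-range n t y) , m≤n⇒m≤1+n (treeColouring≤ n t y)
    proper : ∀ y z → AdjN n y z → f y ≢ f z
    proper y z adj with recolour-view n x top g y | recolour-view n x top g z
    ... | inj₁ (y≡x , _) | inj₁ (z≡x , _) =
      ⊥-elim (treeColouring-proper n t y z adj (cong g (trans y≡x (sym z≡x))))
    ... | inj₁ (_ , fy) | inj₂ (_ , fz) = λ e →
      ≤⇒≢suc (treeColouring≤ n t z) (trans (sym fz) (trans (sym e) fy))
    ... | inj₂ (_ , fy) | inj₁ (_ , fz) = λ e →
      ≤⇒≢suc (treeColouring≤ n t y) (trans (sym fy) (trans e fz))
    ... | inj₂ (_ , fy) | inj₂ (_ , fz) = λ e →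
      treeColouring-proper n t y z adj (trans (sym fy) (trans e fz))
    topOrBelow : ∀ b → TopOrBelowLevelAlong n f b
    topOrBelow b y _ with recolour-view n x top g y
    ... | inj₁ (_ , f≡top) = inj₂ (subst (top ≤_) (sym f≡top) ≤-refl)
    ... | inj₂ (_ , f≡g) =
      inj₁ (subst (_≤ levelN n y) (sym f≡g) (proj₂ (treeColouring-range n t y)))
    unique : ∀ u → extendToBranches n f u ≡ top → u ≡ inj₁ x
    unique (inj₁ y) f≡top with recolour-view n x top g y
    ... | inj₁ (y≡x , _) = cong inj₁ y≡x
    ... | inj₂ (_ , f≡g) =
      ⊥-elim (≤⇒≢suc (treeColouring≤ n t y) (trans (sym f≡g) f≡top))
    unique (inj₂ b) bc≡top =
      ⊥-elim (offBranch x (subst (Pre n x) (sym b≡t) (onBranchThrough n x)) refl)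
      where
      byLevel : ColouredByLevelAlong n f b
      byLevel = branchColour≡top⇒byLevel n f b bc≡top
      offBranch : ∀ y → Pre n y b → y ≢ x
      offBranch y p refl =
        ≤⇒≢suc (levelN≤ n y) (trans (sym (byLevel y p)) (recolour-self n x top g))
      gByLevel : ColouredByLevelAlong n g b
      gByLevel y p with recolour-view n x top g y
      ... | inj₁ (y≡x , _) = ⊥-elim (offBranch y p y≡x)
      ... | inj₂ (_ , f≡g) = trans (sym f≡g) (byLevel y p)
      b≡t : b ≡ t
      b≡t = treeColouring-byLevel-unique n t b gByLevel

lemma2 : (∀ (k : ℕ) → 1 ≤ k → (v : V k) →
    Σ (V k → ℕ) λ c → ProperColoring k c × (c v ≡ k) × (∀ u → c u ≡ k → u ≡ v))
    × (∀ (k : ℕ) → 1 ≤ k → (v : V k) → IsBranch k v →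
    Σ (V k → ℕ) λ c → ProperColoring k c × (c v ≡ k) × (∀ u → c u ≡ k → u ≡ v)
    × (∀ w i → Adj k v w → AtLevel k w i → c w ≡ i))
lemma2 = unique-top , branch-unique-top
  where
  unique-top : ∀ (k : ℕ) → 1 ≤ k → (v : V k) →
    Σ (V k → ℕ) λ c → ProperColoring k c × (c v ≡ k) × (∀ u → c u ≡ k → u ≡ v)
  unique-top (suc n) _ v = colouring n v , colouring-isTop n v
  branch-unique-top : ∀ (k : ℕ) → 1 ≤ k → (v : V k) → IsBranch k v →
    Σ (V k → ℕ) λ c → ProperColoring k c × (c v ≡ k) × (∀ u → c u ≡ k → u ≡ v)
    × (∀ w i → Adj k v w → AtLevel k w i → c w ≡ i)
  branch-unique-top (suc (suc n)) _ (inj₂ t) _ =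
    let proper , top , unique = colouring-isTop (suc n) (inj₂ t)
    in colouring (suc n) (inj₂ t) , proper , top , unique , neighbourLevels
    where
    neighbourLevels : ∀ w i → AdjW (suc n) (inj₂ t) w → AtLevel (suc (suc n)) w i →
      colouring (suc n) (inj₂ t) w ≡ i
    neighbourLevels (inj₁ x) i p level≡i = trans (treeColouring-byLevel n t x p) level≡i
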